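{- Let $A$ be any set of permutations and, for an integer $L$, let $A_{\le L}$ denote the set of permutations in $A$ of length at most $L$ (and similarly for other sets). Then for all positive integers $N\ge n$ and $m$, \[ A_{\le n}\subseteq \mathrm{Av}(\mathsf{BiSC}(A_{\le N},m))_{\le n}. \] Furthermore, if $A=\mathrm{Av}(L)$ for a finite list $L$ of mesh patterns (classical or not) whose longest pattern has length $k$, and if $N\ge n\ge k$ and $m\ge k$, then \[ A_{\le n}= \mathrm{Av}(\mathsf{BiSC}(A_{\le N},m))_{\le n}. \]
   Context: For a word $w$ of distinct integers, $\mathrm{fl}(w)$ replaces the $i$-th smallest letter by $i$. A mesh pattern is a pair $(p,R)$ with $p$ a permutation of length $k$ and $R\subseteq\{0,\dots,k\}\times\{0,\dots,k\}$; a classical pattern $p$ is identified with $(p,\emptyset)$. An occurrence of $(p,R)$ in a permutation $\pi$ of length $n$ is a sequence $1\le j_1<\dots<j_k\le n$ with $\mathrm{fl}(\pi_{j_1}\cdots\pi_{j_k})=p$ such that, with $j_0=0$, $j_{k+1}=n+1$ and $v_0<\dots<v_{k+1}$ being $0$, the sorted values $\pi_{j_i}$, and $n+1$, for each $(a,b)\in R$ no index $x$ satisfies $j_a<x<j_{a+1}$ and $v_b<\pi_x<v_{b+1}$. $\pi$ contains $(p,R)$ if an occurrence exists; $\mathrm{Av}(M)$ is the set of permutations avoiding all mesh patterns in $M$. The maximal shading of an occurrence of $p$ in $\pi$ is the set of all boxes $(a,b)$ with no such point $x$. $\mathsf{Mine}(B,m)$, for a finite set $B$ of permutations: for each classical pattern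 $p$ of length at most $m$ output $(p,\mathrm{sh}_p)$, where $\mathrm{sh}_p$ is the set of inclusion-maximal elements among the maximal shadings of all occurrences of $p$ in permutations of $B$ (empty if $p$ occurs in none). $\mathsf{Forb}(S)$: for each $(p,\mathrm{sh}_p)\in S$ (processed in order of increasing length of $p$), let $\mathrm{forb}_p$ be the set of inclusion-minimal subsets $R\subseteq\{0,\dots,k\}^2$ that are not contained in any member of $\mathrm{sh}_p$; then remove from $\mathrm{forb}_p$ every $R$ that is a consequence of some shading in $\mathrm{forb}_q$ for a classical pattern $q$ properly contained in $p$ processed earlier, meaning that there is $R'\in\mathrm{forb}_q$ such that every permutation containing $(p,R)$ also contains $(q,R')$. The output is the set of mesh patterns $(p,R)$ with $R\in\mathrm{forb}_p$. $\mathsf{BiSC}(B,m)=\mathsf{Forb}(\mathsf{Mine}(B,m))$. -}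

module Defs where

open import Data.Nat using (ℕ; zero; suc; _<_; _≤_; _<ᵇ_; _+_)
open import Data.Nat.Properties using (_<?_; _≟_)
open import Data.Fin using (Fin; toℕ; zero; suc)
open import Data.Bool using (Bool; true; false; if_then_else_)
open import Data.Product using (Σ; _×_; _,_)
open import Data.Sum using (_⊎_)
open import Data.Empty using (⊥)
open import Relation.Nullary using (¬_; yes; no)
open import Relation.Binary.PropositionalEquality using (_≡_)
open import Function.Definitions using (Injective)

-- Permutations of length n: injective maps Fin n → Fin n.
-- Position i (0-based Fin) carries the 1-based value  val π i.

Perm : ℕ → Set
Perm n = Σ (Fin n → Fin n) (Injective _≡_ _≡_)

pos : ∀ {n} → Fin n → ℕ
pos x = suc (toℕ x)

val : ∀ {n} → Perm n → Fin n → ℕ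
val (f , _) i = suc (toℕ (f i))

PermSet : Set₁
PermSet = (l : ℕ) → Perm l → Set

Restrict : PermSet → ℕ → PermSet
Restrict A L l π = A l π × l ≤ L

-- Flattening: fl(w)_i = number of letters of w smaller than w_i (+1);
-- we use the 0-based rank  rank w (w i), to be compared with toℕ (p i).

rank : ∀ {k} → (Fin k → ℕ) → ℕ → ℕ
rank {zero} w x = 0
rank {suc k} w x = (if w zero <ᵇ x then 1 else 0) + rank {k} (λ i → w (suc i)) x

Shading : ℕ → Set
Shading k = Fin (suc k) → Fin (suc k) → Bool

_⊆ˢ_ : ∀ {k} → Shading k → Shading k → Set
R ⊆ˢ S = ∀ a b → R a b ≡ true → S a b ≡ true

∅ˢ : ∀ {k} → Shading k
∅ˢ a b = false

record MeshPattern : Set where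
  constructor mesh
  field
    len   : ℕ
    pat   : Perm len
    shade : Shading len
open MeshPattern public

module _ {k n : ℕ} (p : Perm k) (π : Perm n) where

  Occ : (Fin k → Fin n) → Set
  Occ j = (∀ a b → toℕ a < toℕ b → toℕ (j a) < toℕ (j b))
        × (∀ a → rank (λ i → val π (j i)) (val π (j a)) ≡ toℕ (proj₁ p a))
    where open import Data.Product using (proj₁)

module _ {k n : ℕ} (π : Perm n) (j : Fin k → Fin n) where

  w : Fin k → ℕ
  w i = val π (j i)

  -- j_t < y  (with j_0 = 0)
  PosLo : ℕ → ℕ → Set
  PosLo t y = t ≡ 0 ⊎ Σ (Fin k) λ i → (suc (toℕ i) ≡ t) × (pos (j i) < y)

  -- y < j_t  (with j_{k+1} = n+1)
  PosHi : ℕ → ℕ → Set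
  PosHi t y = t ≡ suc k ⊎ Σ (Fin k) λ i → (suc (toℕ i) ≡ t) × (y < pos (j i))

  -- v_t < y, where v_t (1 ≤ t ≤ k) is the t-th smallest occurrence value, v_0 = 0
  ValLo : ℕ → ℕ → Set
  ValLo t y = t ≡ 0 ⊎ Σ (Fin k) λ i → (suc (rank w (w i)) ≡ t) × (w i < y)

  -- y < v_t, with v_{k+1} = n+1
  ValHi : ℕ → ℕ → Set
  ValHi t y = t ≡ suc k ⊎ Σ (Fin k) λ i → (suc (rank w (w i)) ≡ t) × (y < w i)

  InBox : Fin (suc k) → Fin (suc k) → Fin n → Set
  InBox a b x = PosLo (toℕ a) (pos x) × PosHi (suc (toℕ a)) (pos x)
              × ValLo (toℕ b) (val π x) × ValHi (suc (toℕ b)) (val π x)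

  BoxEmpty : Fin (suc k) → Fin (suc k) → Set
  BoxEmpty a b = ∀ x → ¬ InBox a b x

  IsMaxShading : Shading k → Set
  IsMaxShading S = ∀ a b → (S a b ≡ true → BoxEmpty a b) × (BoxEmpty a b → S a b ≡ true)

MeshOcc : ∀ {n} → Perm n → (P : MeshPattern) → (Fin (len P) → Fin n) → Set
MeshOcc π P j = Occ (pat P) π j × (∀ a b → shade P a b ≡ true → BoxEmpty π j a b)

Contains : ∀ {n} → Perm n → MeshPattern → Set
Contains {n} π P = Σ (Fin (len P) → Fin n) (MeshOcc π P)

Av : (MeshPattern → Set) → PermSet
Av M l π = ∀ P → M P → ¬ Contains π P

module _ (B : PermSet) where

  Shades : ∀ {k} → Perm k → Shading k → Set
  Shades {k} p S = Σ ℕ λ n → Σ (Perm n) λ π → B n π ×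
                   Σ (Fin k → Fin n) λ j → Occ p π j × IsMaxShading π j S

  InSh : ∀ {k} → Perm k → Shading k → Set
  InSh p S = Shades p S × (∀ S' → Shades p S' → S ⊆ˢ S' → S' ⊆ˢ S)

  NotCovered : ∀ {k} → Perm k → Shading k → Set
  NotCovered p R = ∀ S → InSh p S → ¬ (R ⊆ˢ S)

  Cand : ∀ {k} → Perm k → Shading k → Set
  Cand p R = NotCovered p R × (∀ R' → R' ⊆ˢ R → NotCovered p R' → R ⊆ˢ R')

Consequence : ∀ {k k'} → Perm k → Shading k → Perm k' → Shading k' → Set
Consequence {k} {k'} p R q R' =
  ∀ n (π : Perm n) → Contains π (mesh k p R) → Contains π (mesh k' q R')

ClassContains : ∀ {k k'} → Perm k' → Perm k → Set
ClassContains {k} {k'} q p = Contains p (mesh k' q ∅ˢ)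

-- Forb, processing patterns by increasing length.
-- ForbUpTo B f j p R : R ∈ forb_p (final), defined for patterns of length j < f.

ForbUpTo : PermSet → ℕ → (j : ℕ) → Perm j → Shading j → Set
ForbUpTo B zero j p R = ⊥
ForbUpTo B (suc f) j p R with j <? f
... | yes _ = ForbUpTo B f j p R
... | no _ with j ≟ f
...   | yes _ = Cand B p R ×
                ¬ (Σ ℕ λ k' → k' < j × Σ (Perm k') λ q → Σ (Shading k') λ R' →
                     ClassContains q p × ForbUpTo B f k' q R' × Consequence p R q R')
...   | no _ = ⊥

Forb : PermSet → (j : ℕ) → Perm j → Shading j → Set
Forb B j p R = ForbUpTo B (suc j) j p R

BiSC : PermSet → ℕ → MeshPattern → Set
BiSC B m P = len P ≤ m × Forb B (len P) (pat P) (shade P)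

module Submission where

open import Defs
open import Data.Nat using (ℕ; _≤_)
open import Data.Product using (_×_)
open import Data.List using (List)
open import Data.List.Relation.Unary.All using (All)
open import Data.List.Relation.Unary.Any using (Any)
open import Data.List.Membership.Propositional using (_∈_)
open import Relation.Binary.PropositionalEquality using (_≡_)
open import Function.Bundles using (_⇔_)

open import Data.Nat using (zero; suc; _<_; _+_; z≤n; s≤s)
open import Data.Nat.Properties
  using (_<?_; _≟_; ≤-refl; ≤-trans; <⇒≤; +-mono-≤; +-mono-<-≤; +-mono-≤-<; n≮n)
open import Data.Nat.Induction using (<-wellFounded)
open import Data.Fin using (Fin; toℕ; zero; suc)
open import Data.Fin.Properties using (any?; all?)
open import Data.Bool using (Bool; true; false)
import Data.Bool.Properties as Bool
open import Data.Product using (Σ; _,_; proj₁; proj₂)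
open import Data.Empty using (⊥; ⊥-elim)
open import Relation.Nullary using (¬_; Dec; yes; no; does; contradiction)
open import Relation.Nullary.Decidable using (_×-dec_; _⊎-dec_; ¬?)
open import Relation.Binary.PropositionalEquality using (refl; sym; trans)
open import Relation.Binary.Construct.On using (wellFounded)
open import Induction.WellFounded using (Acc; acc)
open import Data.List.Relation.Unary.All using (lookup)
open import Function.Bundles using (mk⇔)
open import Function using (_on_)

-- Both inclusions rest on one finiteness fact: shadings are
-- Boolean (k+1)×(k+1) matrices, so every shading satisfying a property Q lies
-- below an inclusion-maximal one and above an inclusion-minimal one.  We prove
-- this "extremal principle" once for the order "S agrees with b wherever R
-- does" (inclusion for b = true, reverse inclusion for b = false), by
-- well-founded recursion on the number of entries differing from b; being
-- constructive it is stated under a double negation, which suffices because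
-- all our goals are negative.
--
-- Soundness: if σ ∈ B contains (p,R), the maximal shading of that occurrence
-- contains R and lies below a maximal element of sh_p, so R ∉ forb_p; hence
-- B ⊆ Av(BiSC(B,m)), which is the first claim for B = A_{≤N}.
-- Completeness: if B ⊆ Av(M) and π contains P ∈ M, then shade P is not covered
-- by sh_p; a minimal uncovered R ⊆ shade P is a candidate contained in π, and
-- either it survives into forb_p or it is a consequence of an earlier
-- forbidden pattern, which π then contains as well.

Matrix : ℕ → ℕ → Set
Matrix r s = Fin r → Fin s → Bool

_≤[_]_ : ∀ {r s} → Matrix r s → Bool → Matrix r s → Set
R ≤[ b ] S = ∀ a c → R a c ≡ b → S a c ≡ b

≤[]-refl : ∀ {r s b} (R : Matrix r s) → R ≤[ b ] R
≤[]-refl R a c e = e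

≤[]-trans : ∀ {r s b} {R S T : Matrix r s} → R ≤[ b ] S → S ≤[ b ] T → R ≤[ b ] T
≤[]-trans R≤S S≤T a c e = S≤T a c (R≤S a c e)

-- For b = true the order is inclusion (definitionally); for b = false it is
-- reverse inclusion, by contraposition on Booleans.
≤[false]⇒⊇ : ∀ {k} {R S : Shading k} → R ≤[ false ] S → S ⊆ˢ R
≤[false]⇒⊇ {R = R} R≤S a c Sac≡true with R a c in Rac
... | true  = refl
... | false = contradiction (trans (sym Sac≡true) (R≤S a c Rac)) λ ()

⊇⇒≤[false] : ∀ {k} {R S : Shading k} → S ⊆ˢ R → R ≤[ false ] S
⊇⇒≤[false] {S = S} S⊆R a c Rac≡false with S a c in Sac
... | false = refl
... | true  = contradiction (trans (sym Rac≡false) (S⊆R a c Sac)) λ ()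

sumFin : ∀ {n} → (Fin n → ℕ) → ℕ
sumFin {zero}  f = 0
sumFin {suc n} f = f zero + sumFin (λ i → f (suc i))

sumFin-mono : ∀ {n} {f g : Fin n → ℕ} → (∀ i → f i ≤ g i) → sumFin f ≤ sumFin g
sumFin-mono {zero}  f≤g = z≤n
sumFin-mono {suc n} f≤g = +-mono-≤ (f≤g _) (sumFin-mono (λ i → f≤g (suc i)))

sumFin-strict : ∀ {n} {f g : Fin n → ℕ} → (∀ i → f i ≤ g i) → ∀ i → f i < g i →
                sumFin f < sumFin g
sumFin-strict f≤g zero    fi<gi = +-mono-<-≤ fi<gi (sumFin-mono (λ i → f≤g (suc i)))
sumFin-strict f≤g (suc i) fi<gi =
  +-mono-≤-< (f≤g _) (sumFin-strict (λ i → f≤g (suc i)) i fi<gi)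

mismatch : Bool → Bool → ℕ
mismatch true  true  = 0
mismatch false false = 0
mismatch true  false = 1
mismatch false true  = 1

mismatch-mono : ∀ b x y → (x ≡ b → y ≡ b) → mismatch b y ≤ mismatch b x
mismatch-mono true  true  y     h with h refl
... | refl = z≤n
mismatch-mono false false y     h with h refl
... | refl = z≤n
mismatch-mono true  false true  _ = z≤n
mismatch-mono true  false false _ = ≤-refl
mismatch-mono false true  false _ = z≤n
mismatch-mono false true  true  _ = ≤-refl

mismatch-strict : ∀ b x y → ¬ x ≡ b → y ≡ b → mismatch b y < mismatch b x
mismatch-strict true  true  _    x≢b _    = contradiction refl x≢b
mismatch-strict false false _    x≢b _    = contradiction refl x≢b
mismatch-strict true  false true  _  refl = s≤s z≤n
mismatch-strict false true  false _  refl = s≤s z≤n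

distance : ∀ {r s} → Bool → Matrix r s → ℕ
distance b S = sumFin (λ a → sumFin (λ c → mismatch b (S a c)))

distance-strict : ∀ {r s b} {R S : Matrix r s} → R ≤[ b ] S →
                  ∀ a c → ¬ R a c ≡ b → S a c ≡ b → distance b S < distance b R
distance-strict {b = b} {R} {S} R≤S a c Rac≢b Sac≡b =
  sumFin-strict (λ a → sumFin-mono (entrywise a)) a
    (sumFin-strict (entrywise a) c (mismatch-strict b (R a c) (S a c) Rac≢b Sac≡b))
  where
  entrywise : ∀ a c → mismatch b (S a c) ≤ mismatch b (R a c)
  entrywise a c = mismatch-mono b (R a c) (S a c) (R≤S a c)

Extremal : ∀ {r s} → Bool → (Matrix r s → Set) → Matrix r s → Set
Extremal {r} {s} b Q S =
  Σ (Matrix r s) λ T → S ≤[ b ] T × Q T × (∀ U → Q U → T ≤[ b ] U → U ≤[ b ] T)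

-- Either S itself is maximal, or some U ≥ S in Q differs from S at an entry,
-- so U is strictly closer to b and recursion applies to it.
extremal : ∀ {r s} b (Q : Matrix r s → Set) S → Q S → ¬ ¬ Extremal b Q S
extremal b Q S = search S (wellFounded (distance b) <-wellFounded S)
  where
  search : ∀ S → Acc (_<_ on distance b) S → Q S → ¬ ¬ Extremal b Q S
  search S (acc closer) QS noExtremal = noExtremal (S , ≤[]-refl S , QS , maximal)
    where
    maximal : ∀ U → Q U → S ≤[ b ] U → U ≤[ b ] S
    maximal U QU S≤U a c Uac≡b with S a c Bool.≟ b
    ... | yes Sac≡b = Sac≡b
    ... | no  Sac≢b = ⊥-elim (search U (closer (distance-strict S≤U a c Sac≢b Uac≡b)) QU
            λ { (T , U≤T , rest) → noExtremal (T , ≤[]-trans S≤U U≤T , rest) })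

module _ {k n : ℕ} (π : Perm n) (j : Fin k → Fin n) where

  inBox? : ∀ a b x → Dec (InBox π j a b x)
  inBox? a b x = posLo? (toℕ a) (pos x) ×-dec posHi? (suc (toℕ a)) (pos x)
               ×-dec valLo? (toℕ b) (val π x) ×-dec valHi? (suc (toℕ b)) (val π x)
    where
    posLo? : ∀ t y → Dec (PosLo π j t y)
    posLo? t y = (t ≟ 0) ⊎-dec any? (λ i → (suc (toℕ i) ≟ t) ×-dec (pos (j i) <? y))
    posHi? : ∀ t y → Dec (PosHi π j t y)
    posHi? t y = (t ≟ suc k) ⊎-dec any? (λ i → (suc (toℕ i) ≟ t) ×-dec (y <? pos (j i)))
    valLo? : ∀ t y → Dec (ValLo π j t y)
    valLo? t y = (t ≟ 0) ⊎-dec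
      any? (λ i → (suc (rank (w π j) (w π j i)) ≟ t) ×-dec (w π j i <? y))
    valHi? : ∀ t y → Dec (ValHi π j t y)
    valHi? t y = (t ≟ suc k) ⊎-dec
      any? (λ i → (suc (rank (w π j) (w π j i)) ≟ t) ×-dec (y <? w π j i))

  boxEmpty? : ∀ a b → Dec (BoxEmpty π j a b)
  boxEmpty? a b = all? (λ x → ¬? (inBox? a b x))

  maxShading : Shading k
  maxShading a b = does (boxEmpty? a b)

  maxShading-correct : IsMaxShading π j maxShading
  maxShading-correct a b = reflects (boxEmpty? a b)
    where
    reflects : ∀ {X : Set} (d : Dec X) → (does d ≡ true → X) × (X → does d ≡ true)
    reflects (yes x) = (λ _ → x) , (λ _ → refl)
    reflects (no ¬x) = (λ ()) , (λ x → contradiction x ¬x)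

shade⊆maxShading : ∀ {n} {π : Perm n} {P : MeshPattern} {j} → MeshOcc π P j →
                   shade P ⊆ˢ maxShading π j
shade⊆maxShading {π = π} {j = j} (_ , empty) a b shaded =
  proj₂ (maxShading-correct π j a b) (empty a b shaded)

ForbStep : PermSet → (j : ℕ) → Perm j → Shading j → Set
ForbStep B j p R = Cand B p R ×
  ¬ (Σ ℕ λ k' → k' < j × Σ (Perm k') λ q → Σ (Shading k') λ R' →
       ClassContains q p × ForbUpTo B j k' q R' × Consequence p R q R')

-- The staged definition decides each length once: ForbUpTo at any stage is
-- the step condition, and the step condition is Forb.
forbUpTo⇒step : ∀ B f j p R → ForbUpTo B f j p R → ForbStep B j p R
forbUpTo⇒step B zero    j p R ()
forbUpTo⇒step B (suc f) j p R x with j <? f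
... | yes _ = forbUpTo⇒step B f j p R x
... | no  _ with j ≟ f
...   | yes refl = x
...   | no  _    = ⊥-elim x

step⇒forb : ∀ B j p R → ForbStep B j p R → Forb B j p R
step⇒forb B j p R x with j <? j
... | yes j<j = contradiction j<j (n≮n j)
... | no  _ with j ≟ j
...   | yes _   = x
...   | no  j≢j = contradiction refl j≢j

forbUpTo⇒forb : ∀ B f j p R → ForbUpTo B f j p R → Forb B j p R
forbUpTo⇒forb B f j p R x = step⇒forb B j p R (forbUpTo⇒step B f j p R x)

realised⇒covered : ∀ {B : PermSet} {n k} {σ : Perm n} {p : Perm k} {R : Shading k} →
                   B n σ → Contains σ (mesh k p R) → ¬ NotCovered B p R
realised⇒covered {B} {n} {k} {σ} {p} {R} Bσ (j , occ@(classical , _)) notCovered =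
  extremal true (Shades B p) (maxShading σ j) realised
    λ { (T , max⊆T , shadesT , maximalT) →
          notCovered T (shadesT , maximalT)
            (λ a b r → max⊆T a b (shade⊆maxShading {π = σ} {mesh k p R} {j} occ a b r)) }
  where
  realised : Shades B p (maxShading σ j)
  realised = n , σ , Bσ , j , classical , maxShading-correct σ j

bisc-sound : ∀ {B : PermSet} m l (π : Perm l) → B l π → Av (BiSC B m) l π
bisc-sound {B} m l π Bπ (mesh k p R) (_ , forb) contains =
  realised⇒covered {B} {σ = π} {p} {R} Bπ contains
    (proj₁ (proj₁ (forbUpTo⇒step B (suc k) k p R forb)))

forbidden⇒uncovered : ∀ {B : PermSet} {M : MeshPattern → Set} →
                      (∀ n σ → B n σ → Av M n σ) → ∀ {P} → M P →
                      NotCovered B (pat P) (shade P)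
forbidden⇒uncovered B⊆AvM MP S ((n , σ , Bσ , j , occ , isMax) , _) P⊆S =
  B⊆AvM n σ Bσ _ MP (j , occ , λ a b shaded → proj₁ (isMax a b) (P⊆S a b shaded))

minimal-candidate : ∀ {B : PermSet} {k} {p : Perm k} {R₀ : Shading k} →
                    NotCovered B p R₀ → ¬ ¬ (Σ (Shading k) λ R → R ⊆ˢ R₀ × Cand B p R)
minimal-candidate {B} {p = p} {R₀} uncovered noCandidate =
  extremal false (NotCovered B p) R₀ uncovered
    λ { (R , R₀≥R , uncoveredR , minimal) →
          noCandidate (R , ≤[false]⇒⊇ R₀≥R , uncoveredR ,
            λ R' R'⊆R uncoveredR' → ≤[false]⇒⊇ (minimal R' uncoveredR' (⊇⇒≤[false] R'⊆R))) }

-- A candidate of length ≤ m is contained in no π avoiding BiSC(B, m): either it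
-- is forbidden itself, or it implies an earlier, shorter forbidden pattern.
candidate-avoided : ∀ {B : PermSet} {m l k} {π : Perm l} {p : Perm k} {R : Shading k} →
                    Av (BiSC B m) l π → k ≤ m → Cand B p R → ¬ Contains π (mesh k p R)
candidate-avoided {B} {m} {l} {k} {π} {p} {R} avoids k≤m cand contains =
  avoids (mesh k p R) (k≤m , step⇒forb B k p R (cand , notConsequence)) contains
  where
  notConsequence : ¬ (Σ ℕ λ k' → k' < k × Σ (Perm k') λ q → Σ (Shading k') λ R' →
                     ClassContains q p × ForbUpTo B k k' q R' × Consequence p R q R')
  notConsequence (k' , k'<k , q , R' , _ , forb' , implies) =
    avoids (mesh k' q R') (≤-trans (<⇒≤ k'<k) k≤m , forbUpTo⇒forb B k k' q R' forb')
      (implies l π contains)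

bisc-complete : ∀ {B : PermSet} {M : MeshPattern → Set} m →
                (∀ n σ → B n σ → Av M n σ) → (∀ P → M P → len P ≤ m) →
                ∀ l (π : Perm l) → Av (BiSC B m) l π → Av M l π
bisc-complete {B} {M} m B⊆AvM short l π avoids P MP (j , occ , empty) =
  minimal-candidate {B} {p = pat P} {R₀ = shade P} (forbidden⇒uncovered {B} {M} B⊆AvM MP)
    λ { (R , R⊆P , cand) →
          candidate-avoided {B} {π = π} {pat P} {R} avoids (short P MP) cand
            (j , occ , λ a b r → empty a b (R⊆P a b r)) }

theorem2p3 :
      (∀ (A : PermSet) (n N m : ℕ) → 1 ≤ n → n ≤ N → 1 ≤ m →
         ∀ l (π : Perm l) → l ≤ n → A l π → Av (BiSC (Restrict A N) m) l π)
    × (∀ (L : List MeshPattern) (k n N m : ℕ) →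
         All (λ P → len P ≤ k) L → Any (λ P → len P ≡ k) L →
         1 ≤ n → n ≤ N → k ≤ n → 1 ≤ m → k ≤ m →
         ∀ l (π : Perm l) → l ≤ n →
           (Av (_∈ L) l π ⇔ Av (BiSC (Restrict (Av (_∈ L)) N) m) l π))
-- Only n ≤ N (so A_{≤n} ⊆ A_{≤N}) and k ≤ m (so every pattern of L is within
-- the mined length) are needed.
theorem2p3 =
  (λ A n N m _ n≤N _ l π l≤n Aπ → bisc-sound m l π (Aπ , ≤-trans l≤n n≤N)) ,
  λ L k n N m lengths≤k _ _ n≤N _ _ k≤m l π l≤n →
    mk⇔ (λ avoidsL → bisc-sound m l π (avoidsL , ≤-trans l≤n n≤N))
        (bisc-complete m (λ _ _ → proj₁) (λ P P∈L → ≤-trans (lookup lengths≤k P∈L) k≤m) l π)
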